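{- Let $\mathbb F$ be a finite field, let $k,\ell\in\mathbb N$ with $k\le\ell$, let $\mathcal X = \mathbb F^\ell$ (viewed as the product of $\ell$ copies of $\mathbb F$, one per player), and let $Q\subseteq\mathbb F^\ell$ be an affine subspace of dimension $k$. Then for every $n\in\mathbb N$, $E_Q(n)\le r_{grid}(\mathbb F,k,n)$.
   Context: For $Q\subseteq\mathcal X = \mathcal X^{(1)}\times\dots\times\mathcal X^{(m)}$ with $q=|Q|$ and $n\in\mathbb N$: for $x\in Q^n\subseteq \mathcal X^n$ write $x_i\in\mathcal X$ for its $i$-th coordinate tuple, $x^{(j)}\in(\mathcal X^{(j)})^n$ for the vector of $j$-th entries, and $x^{(j)}_i$ for the $j$-th entry of $x_i$. A set $W\subseteq Q^n$ contains a forbidden subgraph if there are $e(1),\dots,e(q)\in W$ and $i\in[n]$ such that (1) $\{e(1)_i,\dots,e(q)_i\}=Q$ and (2) for every $j\in[m]$ and $r,r'\in[q]$, $e(r)^{(j)}_i=e(r')^{(j)}_i$ implies $e(r)^{(j)}=e(r')^{(j)}$. $E_Q(n)$ is the maximum of $|W|/q^n$ over all $W\subseteq Q^n$ containing no forbidden subgraph. A grid in $(\mathbb F^n)^k$ is a set $\{x+\alpha\otimes d : \alpha\in\mathbb F^k\}$ with $x\in(\mathbb F^n)^k$, $d\in\mathbb F^n$, $d\ne 0$, where $\alpha\otimes d = (\alpha^{(1)}d,\dots,\alpha^{(k)}d)\in(\mathbb F^n)^k$. $r_{grid}(\mathbb F,k,n)$ is the maximum of $|A|/|\mathbb F|^{kn}$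 over sets $A\subseteq(\mathbb F^n)^k$ containing no grid. -}

module Defs where

import Data.Nat as ℕ
open ℕ using (ℕ)
open import Data.Fin using (Fin)
open import Data.Vec using (Vec; []; _∷_; lookup; map; zipWith; replicate; foldr)
open import Data.Vec.Relation.Unary.All using (All)
open import Data.List using (List; length)
open import Data.List.Membership.Propositional using (_∈_)
open import Data.List.Relation.Unary.Unique.Propositional using (Unique)
open import Data.Product using (Σ; ∃; ∃-syntax; _×_)
open import Relation.Nullary using (¬_)
open import Relation.Binary.PropositionalEquality using (_≡_; _≢_)
open import Relation.Binary.Definitions using (DecidableEquality)
open import Algebra.Structures using (IsCommutativeRing)
open import Function.Bundles using (_⇔_)

record FiniteField : Set₁ where
  field
    Carrier  : Set
    _+_ _*_  : Carrier → Carrier → Carrier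
    -_       : Carrier → Carrier
    0# 1#    : Carrier
    isCommutativeRing : IsCommutativeRing _≡_ _+_ _*_ -_ 0# 1#
    0≢1      : 0# ≢ 1#
    inverse  : ∀ x → x ≢ 0# → ∃[ y ] (x * y ≡ 1#)
    _≟_      : DecidableEquality Carrier
    elements : List Carrier
    complete : ∀ x → x ∈ elements
    distinct : Unique elements

  size : ℕ
  size = length elements

module _ (𝔽 : FiniteField) where
  open FiniteField 𝔽

  _+ᵥ_ : ∀ {n} → Vec Carrier n → Vec Carrier n → Vec Carrier n
  _+ᵥ_ = zipWith _+_

  _·ᵥ_ : ∀ {n} → Carrier → Vec Carrier n → Vec Carrier n
  a ·ᵥ v = map (a *_) v

  0ᵥ : ∀ {n} → Vec Carrier n
  0ᵥ = replicate _ 0#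

  lincomb : ∀ {ℓ k} → Vec Carrier k → Vec (Vec Carrier ℓ) k → Vec Carrier ℓ
  lincomb α v = foldr _ _+ᵥ_ 0ᵥ (zipWith _·ᵥ_ α v)

  IsAffineSubspace : ∀ {ℓ} (k : ℕ) → List (Vec Carrier ℓ) → Set
  IsAffineSubspace {ℓ} k Q =
    Σ (Vec Carrier ℓ) λ p → Σ (Vec (Vec Carrier ℓ) k) λ v →
      (∀ (α : Vec Carrier k) → lincomb α v ≡ 0ᵥ → α ≡ 0ᵥ)
      × (∀ (y : Vec Carrier ℓ) → (y ∈ Q) ⇔ (∃[ α ] (y ≡ p +ᵥ lincomb α v)))

  -- Forbidden subgraphs.  X = F^ℓ (player j holds the j-th entry), so an
  -- element x ∈ X^n is a Vec (Vec F ℓ) n: x_i = lookup x i,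
  -- x^(j) = column j x, x^(j)_i = lookup (lookup x i) j.

  column : ∀ {ℓ n} → Fin ℓ → Vec (Vec Carrier ℓ) n → Vec Carrier n
  column j x = map (λ xi → lookup xi j) x

  InPower : ∀ {ℓ n} → List (Vec Carrier ℓ) → Vec (Vec Carrier ℓ) n → Set
  InPower Q x = All (λ xi → xi ∈ Q) x

  ContainsForbiddenSubgraph : ∀ {ℓ} (n : ℕ) (Q : List (Vec Carrier ℓ)) →
    List (Vec (Vec Carrier ℓ) n) → Set
  ContainsForbiddenSubgraph {ℓ} n Q W =
    Σ (Fin (length Q) → Vec (Vec Carrier ℓ) n) λ e → Σ (Fin n) λ i →
      (∀ r → e r ∈ W)
      × (∀ r → lookup (e r) i ∈ Q)
      × (∀ y → y ∈ Q → ∃[ r ] (lookup (e r) i ≡ y))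
      × (∀ (j : Fin ℓ) (r r' : Fin (length Q)) →
           lookup (lookup (e r) i) j ≡ lookup (lookup (e r') i) j →
           column j (e r) ≡ column j (e r'))

  -- Grids in (F^n)^k; an element is a Vec (Vec F n) k.

  gridPoint : ∀ {n k} → Vec (Vec Carrier n) k → Vec Carrier k → Vec Carrier n →
    Vec (Vec Carrier n) k
  gridPoint x α d = zipWith (λ xt αt → xt +ᵥ (αt ·ᵥ d)) x α

  ContainsGrid : ∀ (n k : ℕ) → List (Vec (Vec Carrier n) k) → Set
  ContainsGrid n k A =
    Σ (Vec (Vec Carrier n) k) λ x → Σ (Vec Carrier n) λ d →
      d ≢ 0ᵥ × (∀ (α : Vec Carrier k) → gridPoint x α d ∈ A)

  -- Both quantities are maxima of ratios over
  -- finite families, so the inequality unfolds to: every admissible W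
  -- is matched by a grid-free A with |W|/q^n ≤ |A|/|F|^{kn}
  -- (cross-multiplied).

  EQ≤rgrid : ∀ {ℓ} (Q : List (Vec Carrier ℓ)) (k n : ℕ) → Set
  EQ≤rgrid {ℓ} Q k n =
    ∀ (W : List (Vec (Vec Carrier ℓ) n)) → Unique W →
      (∀ x → x ∈ W → InPower Q x) →
      ¬ ContainsForbiddenSubgraph n Q W →
      Σ (List (Vec (Vec Carrier n) k)) λ A → Unique A ×
        ¬ ContainsGrid n k A ×
        (length W ℕ.* size ℕ.^ (k ℕ.* n) ℕ.≤ length A ℕ.* length Q ℕ.^ n)

{-# OPTIONS --safe #-}
-- Parametrise Q by the injection φ α = p + Σₜ αₜ vₜ from F^k, and apply φ to every
-- coordinate: ψ y = (φ (y^(1)ᵢ, …, y^(k)ᵢ))ᵢ maps (F^n)^k onto Q^n. For admissible W take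
-- A = ψ⁻¹ W, so |A| = |W| while |F|^(kn) ≤ q^n. If A contained a grid x + α ⊗ d with
-- dᵢ ≠ 0, then ψ (x + α ⊗ d) has i-th coordinate ψ(x)ᵢ + dᵢ · Σₜ αₜ vₜ, which as α varies runs through
-- all of Q, and j-th player vector ψ(x)^(j) + (Σₜ αₜ vₜ)ⱼ · d, which is determined by its
-- i-th entry: the images form a forbidden subgraph in W.
module Submission where

open import Defs hiding (_+ᵥ_; _·ᵥ_; 0ᵥ; lincomb; column; gridPoint)
import Defs
open import Data.Nat using (ℕ; _≤_)
open import Data.Vec using (Vec)
open import Data.List using (List)
open import Data.List.Relation.Unary.Unique.Propositional using (Unique)

import Data.Nat as ℕ
import Data.Nat.Properties as ℕ
open import Data.Fin using (Fin; zero; suc)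
open import Data.Fin.Properties using (injective⇒≤; *↔×)
open import Data.Vec using ([]; _∷_; lookup; tabulate; map; replicate)
open import Data.Vec.Properties
  using (∷-injective; lookup-zipWith; lookup-map; lookup∘tabulate; tabulate∘lookup;
         tabulate-cong; tabulate-∘; map-cong; map-∘; map-replicate; zipWith-assoc; zipWith-identityˡ)
import Data.Vec.Relation.Unary.All.Properties as Allᵥ
import Data.List as List
open import Data.List.Properties using (length-map)
open import Data.List.Membership.Propositional using (_∈_)
open import Data.List.Membership.Propositional.Properties using (∈-lookup; ∈-map⁺)
open import Data.List.Relation.Unary.Any using (here; there; index)
open import Data.List.Relation.Unary.Any.Properties using (lookup-index)
import Data.List.Relation.Unary.All as All
open import Data.List.Relation.Unary.AllPairs using (_∷_)
open import Data.List.Relation.Unary.Unique.Propositional.Properties using (map⁻)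
open import Data.Product using (∃; ∃-syntax; _×_; _,_; proj₁; proj₂; uncurry)
open import Data.Product.Function.NonDependent.Propositional using (_×-↣_)
open import Data.Empty using (⊥-elim)
open import Relation.Nullary using (¬_; yes; no)
open import Relation.Binary.PropositionalEquality
open import Function using (_∘_; _↣_; _⇔_; mk↣; Injection; Equivalence)
open import Function.Construct.Composition using (_↣-∘_)
open import Function.Properties.Inverse using (↔⇒↣)
open import Algebra.Bundles using (CommutativeRing)

module _ {a} {A : Set a} where

  Unique⇒lookup-injective : ∀ {xs : List A} → Unique xs →
    ∀ i j → List.lookup xs i ≡ List.lookup xs j → i ≡ j
  Unique⇒lookup-injective (_ ∷ _)      zero    zero    _  = refl
  Unique⇒lookup-injective (x∉xs ∷ _)   zero    (suc j) eq = ⊥-elim (All.lookup x∉xs (∈-lookup j) eq)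
  Unique⇒lookup-injective (x∉xs ∷ _)   (suc i) zero    eq = ⊥-elim (All.lookup x∉xs (∈-lookup i) (sym eq))
  Unique⇒lookup-injective (_ ∷ unique) (suc i) (suc j) eq = cong suc (Unique⇒lookup-injective unique i j eq)

  ↣-into⇒≤-length : ∀ {m} {xs : List A} (f : Fin m ↣ A) →
    (∀ i → Injection.to f i ∈ xs) → m ≤ List.length xs
  ↣-into⇒≤-length {xs = xs} f f∈xs = injective⇒≤ λ {i} {j} eq →
    Injection.injective f (trans (lookup-index (f∈xs i))
                          (trans (cong (List.lookup xs) eq) (sym (lookup-index (f∈xs j)))))

  ∷-↣ : ∀ {k} → (A × Vec A k) ↣ Vec A (ℕ.suc k)
  ∷-↣ = mk↣ {to = uncurry _∷_} λ eq → let x≡y , xs≡ys = ∷-injective eq in cong₂ _,_ x≡y xs≡ys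

  Fin^↣Vec : ∀ {m} → Fin m ↣ A → ∀ k → Fin (m ℕ.^ k) ↣ Vec A k
  Fin^↣Vec f ℕ.zero    = mk↣ {to = λ _ → []} λ { {zero} {zero} _ → refl }
  Fin^↣Vec f (ℕ.suc k) = ∷-↣ ↣-∘ ((f ×-↣ Fin^↣Vec f k) ↣-∘ ↔⇒↣ *↔×)

module _ {a b} {A : Set a} {B : Set b} (f : A → B) where

  map-preimage : ∀ (ys : List B) → (∀ y → y ∈ ys → ∃[ x ] f x ≡ y) →
    ∃[ xs ] List.map f xs ≡ ys
  map-preimage List.[]       _   = List.[] , refl
  map-preimage (y List.∷ ys) pre =
    let x , fx≡y   = pre y (here refl)
        xs , fxs≡ys = map-preimage ys (λ y′ → pre y′ ∘ there)
    in x List.∷ xs , cong₂ List._∷_ fx≡y fxs≡ys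

module _ (𝔽 : FiniteField) where
  open FiniteField 𝔽 using (Carrier; isCommutativeRing; inverse; _≟_; distinct; size)

  private
    commutativeRing : CommutativeRing _ _
    commutativeRing = record { isCommutativeRing = isCommutativeRing }

  open CommutativeRing commutativeRing
    using (_+_; _*_; -_; 0#; 1#; +-assoc; +-comm; +-identityˡ; +-identityʳ; -‿inverseˡ; -‿inverseʳ;
           *-assoc; *-comm; *-identityˡ; distribˡ; distribʳ; zeroʳ; +-group; +-commutativeSemigroup; ring)
  open import Algebra.Properties.Group +-group using (∙-cancelˡ; x∙y⁻¹≈ε⇒x≈y)
  open import Algebra.Properties.CommutativeSemigroup +-commutativeSemigroup using (interchange)
  open import Algebra.Properties.Ring ring using (-1*x≈-x)
  open ≡-Reasoning

  *-cancelˡ-≢0 : ∀ {c s t} → c ≢ 0# → c * s ≡ c * t → s ≡ t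
  *-cancelˡ-≢0 {c} {s} {t} c≢0 cs≡ct =
    let c⁻¹ , cc⁻¹≡1 = inverse c c≢0
        cancel : ∀ u → c⁻¹ * (c * u) ≡ u
        cancel u = begin
          c⁻¹ * (c * u) ≡⟨ *-assoc c⁻¹ c u ⟨
          (c⁻¹ * c) * u ≡⟨ cong (_* u) (trans (*-comm c⁻¹ c) cc⁻¹≡1) ⟩
          1# * u        ≡⟨ *-identityˡ u ⟩
          u             ∎
    in trans (sym (cancel s)) (trans (cong (c⁻¹ *_) cs≡ct) (cancel t))

  +-*-solvable : ∀ {c} → c ≢ 0# → ∀ a b → ∃[ t ] a + c * t ≡ b
  +-*-solvable {c} c≢0 a b = c⁻¹ * (b + - a) , (begin
      a + c * (c⁻¹ * (b + - a)) ≡⟨ cong (a +_) (*-assoc c c⁻¹ _) ⟨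
      a + (c * c⁻¹) * (b + - a) ≡⟨ cong (λ e → a + e * (b + - a)) cc⁻¹≡1 ⟩
      a + 1# * (b + - a)        ≡⟨ cong (a +_) (*-identityˡ _) ⟩
      a + (b + - a)             ≡⟨ +-comm a _ ⟩
      (b + - a) + a             ≡⟨ +-assoc b (- a) a ⟩
      b + (- a + a)             ≡⟨ cong (b +_) (-‿inverseˡ a) ⟩
      b + 0#                    ≡⟨ +-identityʳ b ⟩
      b                         ∎)
    where
    c⁻¹ : Carrier
    c⁻¹ = proj₁ (inverse c c≢0)
    cc⁻¹≡1 : c * c⁻¹ ≡ 1#
    cc⁻¹≡1 = proj₂ (inverse c c≢0)

  infixl 6 _+ᵥ_ _-ᵥ_
  infixr 7 _·ᵥ_

  _+ᵥ_ : ∀ {n} → Vec Carrier n → Vec Carrier n → Vec Carrier n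
  _+ᵥ_ = Defs._+ᵥ_ 𝔽

  _·ᵥ_ : ∀ {n} → Carrier → Vec Carrier n → Vec Carrier n
  _·ᵥ_ = Defs._·ᵥ_ 𝔽

  0ᵥ : ∀ {n} → Vec Carrier n
  0ᵥ = Defs.0ᵥ 𝔽

  -- Subtraction goes through the scalar action, so that lincomb-·ᵥ covers it.
  _-ᵥ_ : ∀ {n} → Vec Carrier n → Vec Carrier n → Vec Carrier n
  u -ᵥ w = u +ᵥ (- 1#) ·ᵥ w

  lincomb : ∀ {ℓ k} → Vec Carrier k → Vec (Vec Carrier ℓ) k → Vec Carrier ℓ
  lincomb = Defs.lincomb 𝔽

  column : ∀ {ℓ n} → Fin ℓ → Vec (Vec Carrier ℓ) n → Vec Carrier n
  column = Defs.column 𝔽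

  gridPoint : ∀ {n k} → Vec (Vec Carrier n) k → Vec Carrier k → Vec Carrier n → Vec (Vec Carrier n) k
  gridPoint = Defs.gridPoint 𝔽

  lookup-+ᵥ : ∀ {n} (u w : Vec Carrier n) i → lookup (u +ᵥ w) i ≡ lookup u i + lookup w i
  lookup-+ᵥ u w i = lookup-zipWith _+_ i u w

  lookup-·ᵥ : ∀ {n} s (u : Vec Carrier n) i → lookup (s ·ᵥ u) i ≡ s * lookup u i
  lookup-·ᵥ s u i = lookup-map i (s *_) u

  +ᵥ-assoc : ∀ {n} (u w z : Vec Carrier n) → (u +ᵥ w) +ᵥ z ≡ u +ᵥ (w +ᵥ z)
  +ᵥ-assoc = zipWith-assoc +-assoc

  +ᵥ-identityˡ : ∀ {n} (u : Vec Carrier n) → 0ᵥ +ᵥ u ≡ u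
  +ᵥ-identityˡ = zipWith-identityˡ +-identityˡ

  +ᵥ-interchange : ∀ {n} (u w y z : Vec Carrier n) → (u +ᵥ w) +ᵥ (y +ᵥ z) ≡ (u +ᵥ y) +ᵥ (w +ᵥ z)
  +ᵥ-interchange []      []      []      []      = refl
  +ᵥ-interchange (a ∷ u) (b ∷ w) (c ∷ y) (d ∷ z) = cong₂ _∷_ (interchange a b c d) (+ᵥ-interchange u w y z)

  +ᵥ-cancelˡ : ∀ {n} (u w z : Vec Carrier n) → u +ᵥ w ≡ u +ᵥ z → w ≡ z
  +ᵥ-cancelˡ []      []      []      _  = refl
  +ᵥ-cancelˡ (a ∷ u) (b ∷ w) (c ∷ z) eq =
    let a+b≡a+c , u+w≡u+z = ∷-injective eq
    in cong₂ _∷_ (∙-cancelˡ a b c a+b≡a+c) (+ᵥ-cancelˡ u w z u+w≡u+z)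

  ·ᵥ-zeroʳ : ∀ {n} s → s ·ᵥ 0ᵥ {n} ≡ 0ᵥ
  ·ᵥ-zeroʳ {n} s = trans (map-replicate (s *_) 0# n) (cong (replicate n) (zeroʳ s))

  ·ᵥ-assoc : ∀ {n} s t (u : Vec Carrier n) → (s * t) ·ᵥ u ≡ s ·ᵥ t ·ᵥ u
  ·ᵥ-assoc s t u = trans (map-cong (*-assoc s t) u) (map-∘ (s *_) (t *_) u)

  ·ᵥ-distribˡ : ∀ {n} s (u w : Vec Carrier n) → s ·ᵥ (u +ᵥ w) ≡ s ·ᵥ u +ᵥ s ·ᵥ w
  ·ᵥ-distribˡ s []      []      = refl
  ·ᵥ-distribˡ s (a ∷ u) (b ∷ w) = cong₂ _∷_ (distribˡ s a b) (·ᵥ-distribˡ s u w)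

  ·ᵥ-distribʳ : ∀ {n} s t (u : Vec Carrier n) → (s + t) ·ᵥ u ≡ s ·ᵥ u +ᵥ t ·ᵥ u
  ·ᵥ-distribʳ s t []      = refl
  ·ᵥ-distribʳ s t (a ∷ u) = cong₂ _∷_ (distribʳ a s t) (·ᵥ-distribʳ s t u)

  -ᵥ-self : ∀ {n} (u : Vec Carrier n) → u -ᵥ u ≡ 0ᵥ
  -ᵥ-self []      = refl
  -ᵥ-self (a ∷ u) = cong₂ _∷_ (trans (cong (a +_) (-1*x≈-x a)) (-‿inverseʳ a)) (-ᵥ-self u)

  -ᵥ≡0ᵥ⇒≡ : ∀ {n} (u w : Vec Carrier n) → u -ᵥ w ≡ 0ᵥ → u ≡ w
  -ᵥ≡0ᵥ⇒≡ []      []      _  = refl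
  -ᵥ≡0ᵥ⇒≡ (a ∷ u) (b ∷ w) eq =
    let a-b≡0 , u-w≡0 = ∷-injective eq
    in cong₂ _∷_ (x∙y⁻¹≈ε⇒x≈y a b (trans (cong (a +_) (sym (-1*x≈-x b))) a-b≡0)) (-ᵥ≡0ᵥ⇒≡ u w u-w≡0)

  +ᵥ-·ᵥ-solvable : ∀ {n c} → c ≢ 0# → ∀ (u w : Vec Carrier n) → ∃[ α ] u +ᵥ c ·ᵥ α ≡ w
  +ᵥ-·ᵥ-solvable c≢0 []      []      = [] , refl
  +ᵥ-·ᵥ-solvable c≢0 (a ∷ u) (b ∷ w) =
    let t , a+ct≡b = +-*-solvable c≢0 a b
        α , u+cα≡w = +ᵥ-·ᵥ-solvable c≢0 u w
    in t ∷ α , cong₂ _∷_ a+ct≡b u+cα≡w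

  ≢0ᵥ⇒nonzero-entry : ∀ {n} (d : Vec Carrier n) → d ≢ 0ᵥ → ∃[ i ] lookup d i ≢ 0#
  ≢0ᵥ⇒nonzero-entry []      d≢0 = ⊥-elim (d≢0 refl)
  ≢0ᵥ⇒nonzero-entry (a ∷ d) a∷d≢0 with a ≟ 0#
  ... | no  a≢0 = zero , a≢0
  ... | yes a≡0 =
    let i , dᵢ≢0 = ≢0ᵥ⇒nonzero-entry d (a∷d≢0 ∘ cong₂ _∷_ a≡0) in suc i , dᵢ≢0

  lincomb-+ᵥ : ∀ {ℓ k} (α β : Vec Carrier k) (v : Vec (Vec Carrier ℓ) k) →
    lincomb (α +ᵥ β) v ≡ lincomb α v +ᵥ lincomb β v
  lincomb-+ᵥ []      []      []      = sym (+ᵥ-identityˡ 0ᵥ)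
  lincomb-+ᵥ (a ∷ α) (b ∷ β) (w ∷ v) = begin
    (a + b) ·ᵥ w +ᵥ lincomb (α +ᵥ β) v
      ≡⟨ cong₂ _+ᵥ_ (·ᵥ-distribʳ a b w) (lincomb-+ᵥ α β v) ⟩
    (a ·ᵥ w +ᵥ b ·ᵥ w) +ᵥ (lincomb α v +ᵥ lincomb β v)
      ≡⟨ +ᵥ-interchange (a ·ᵥ w) (b ·ᵥ w) (lincomb α v) (lincomb β v) ⟩
    (a ·ᵥ w +ᵥ lincomb α v) +ᵥ (b ·ᵥ w +ᵥ lincomb β v) ∎

  lincomb-·ᵥ : ∀ {ℓ k} s (α : Vec Carrier k) (v : Vec (Vec Carrier ℓ) k) →
    lincomb (s ·ᵥ α) v ≡ s ·ᵥ lincomb α v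
  lincomb-·ᵥ s []      []      = sym (·ᵥ-zeroʳ s)
  lincomb-·ᵥ s (a ∷ α) (w ∷ v) = begin
    (s * a) ·ᵥ w +ᵥ lincomb (s ·ᵥ α) v  ≡⟨ cong₂ _+ᵥ_ (·ᵥ-assoc s a w) (lincomb-·ᵥ s α v) ⟩
    s ·ᵥ a ·ᵥ w +ᵥ s ·ᵥ lincomb α v     ≡⟨ ·ᵥ-distribˡ s (a ·ᵥ w) (lincomb α v) ⟨
    s ·ᵥ (a ·ᵥ w +ᵥ lincomb α v)        ∎

  lincomb-injective : ∀ {ℓ k} (v : Vec (Vec Carrier ℓ) k) →
    (∀ α → lincomb α v ≡ 0ᵥ → α ≡ 0ᵥ) →
    ∀ α β → lincomb α v ≡ lincomb β v → α ≡ β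
  lincomb-injective v independent α β eq = -ᵥ≡0ᵥ⇒≡ α β (independent (α -ᵥ β) (begin
    lincomb (α -ᵥ β) v                   ≡⟨ lincomb-+ᵥ α _ v ⟩
    lincomb α v +ᵥ lincomb (- 1# ·ᵥ β) v ≡⟨ cong (lincomb α v +ᵥ_) (lincomb-·ᵥ (- 1#) β v) ⟩
    lincomb α v -ᵥ lincomb β v           ≡⟨ cong (_-ᵥ lincomb β v) eq ⟩
    lincomb β v -ᵥ lincomb β v           ≡⟨ -ᵥ-self (lincomb β v) ⟩
    0ᵥ                                   ∎))

  column-gridPoint : ∀ {n k} (x : Vec (Vec Carrier n) k) α d i →
    column i (gridPoint x α d) ≡ column i x +ᵥ lookup d i ·ᵥ α
  column-gridPoint []       []      d i = refl
  column-gridPoint (xₜ ∷ x) (a ∷ α) d i = cong₂ _∷_ head (column-gridPoint x α d i)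
    where
    head : lookup (xₜ +ᵥ a ·ᵥ d) i ≡ lookup xₜ i + lookup d i * a
    head = begin
      lookup (xₜ +ᵥ a ·ᵥ d) i        ≡⟨ lookup-+ᵥ xₜ (a ·ᵥ d) i ⟩
      lookup xₜ i + lookup (a ·ᵥ d) i ≡⟨ cong (lookup xₜ i +_) (trans (lookup-·ᵥ a d i) (*-comm a _)) ⟩
      lookup xₜ i + lookup d i * a    ∎

  column≡tabulate : ∀ {ℓ n} j (M : Vec (Vec Carrier ℓ) n) → column j M ≡ tabulate (λ i → lookup (lookup M i) j)
  column≡tabulate j M = begin
    map (λ row → lookup row j) M                     ≡⟨ cong (map _) (tabulate∘lookup M) ⟨
    map (λ row → lookup row j) (tabulate (lookup M)) ≡⟨ tabulate-∘ _ (lookup M) ⟨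
    tabulate (λ i → lookup (lookup M i) j)           ∎

  fromColumns : ∀ {n k} → (Fin n → Vec Carrier k) → Vec (Vec Carrier n) k
  fromColumns c = tabulate (λ t → tabulate (λ i → lookup (c i) t))

  column-fromColumns : ∀ {n k} (c : Fin n → Vec Carrier k) i → column i (fromColumns c) ≡ c i
  column-fromColumns c i = begin
    column i (fromColumns c)                                    ≡⟨ tabulate-∘ _ _ ⟨
    tabulate (λ t → lookup (tabulate (λ i → lookup (c i) t)) i) ≡⟨ tabulate-cong (λ t → lookup∘tabulate _ i) ⟩
    tabulate (lookup (c i))                                     ≡⟨ tabulate∘lookup (c i) ⟩
    c i                                                         ∎

  Fin-size↣Carrier : Fin size ↣ Carrier
  Fin-size↣Carrier = mk↣ (Unique⇒lookup-injective distinct _ _)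

  module Parametrisation {ℓ k} (p : Vec Carrier ℓ) (v : Vec (Vec Carrier ℓ) k) where

    φ : Vec Carrier k → Vec Carrier ℓ
    φ α = p +ᵥ lincomb α v

    ψ : ∀ {n} → Vec (Vec Carrier n) k → Vec (Vec Carrier ℓ) n
    ψ y = tabulate (λ i → φ (column i y))

    φ-injective : (∀ α → lincomb α v ≡ 0ᵥ → α ≡ 0ᵥ) → ∀ {α β} → φ α ≡ φ β → α ≡ β
    φ-injective independent {α} {β} eq = lincomb-injective v independent α β (+ᵥ-cancelˡ p _ _ eq)

    lookup-ψ : ∀ {n} (y : Vec (Vec Carrier n) k) i → lookup (ψ y) i ≡ φ (column i y)
    lookup-ψ y i = lookup∘tabulate _ i

    φ-column-gridPoint : ∀ {n} (x : Vec (Vec Carrier n) k) α d i →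
      φ (column i (gridPoint x α d)) ≡ φ (column i x) +ᵥ lookup d i ·ᵥ lincomb α v
    φ-column-gridPoint x α d i = begin
      p +ᵥ lincomb (column i (gridPoint x α d)) v
        ≡⟨ cong (λ c → p +ᵥ lincomb c v) (column-gridPoint x α d i) ⟩
      p +ᵥ lincomb (column i x +ᵥ lookup d i ·ᵥ α) v
        ≡⟨ cong (p +ᵥ_) (trans (lincomb-+ᵥ (column i x) (lookup d i ·ᵥ α) v)
                            (cong (lincomb (column i x) v +ᵥ_) (lincomb-·ᵥ (lookup d i) α v))) ⟩
      p +ᵥ (lincomb (column i x) v +ᵥ lookup d i ·ᵥ lincomb α v)
        ≡⟨ +ᵥ-assoc p (lincomb (column i x) v) (lookup d i ·ᵥ lincomb α v) ⟨
      φ (column i x) +ᵥ lookup d i ·ᵥ lincomb α v ∎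

    entry-ψ-gridPoint : ∀ {n} (x : Vec (Vec Carrier n) k) α d i j →
      lookup (lookup (ψ (gridPoint x α d)) i) j
        ≡ lookup (φ (column i x)) j + lookup d i * lookup (lincomb α v) j
    entry-ψ-gridPoint x α d i j = begin
      lookup (lookup (ψ (gridPoint x α d)) i) j
        ≡⟨ cong (λ row → lookup row j) (trans (lookup-ψ (gridPoint x α d) i) (φ-column-gridPoint x α d i)) ⟩
      lookup (φ (column i x) +ᵥ lookup d i ·ᵥ lincomb α v) j
        ≡⟨ lookup-+ᵥ (φ (column i x)) (lookup d i ·ᵥ lincomb α v) j ⟩
      lookup (φ (column i x)) j + lookup (lookup d i ·ᵥ lincomb α v) j
        ≡⟨ cong (lookup (φ (column i x)) j +_) (lookup-·ᵥ (lookup d i) (lincomb α v) j) ⟩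
      lookup (φ (column i x)) j + lookup d i * lookup (lincomb α v) j ∎

    module _ (Q : List (Vec Carrier ℓ)) (Q≡imφ : ∀ y → (y ∈ Q) ⇔ (∃[ α ] y ≡ φ α)) where

      φ-onto : ∀ {y} → y ∈ Q → ∃[ α ] φ α ≡ y
      φ-onto y∈Q = let α , y≡φα = Equivalence.to (Q≡imφ _) y∈Q in α , sym y≡φα

      size^k≤|Q| : (∀ α → lincomb α v ≡ 0ᵥ → α ≡ 0ᵥ) → size ℕ.^ k ≤ List.length Q
      size^k≤|Q| independent = ↣-into⇒≤-length (mk↣ (φ-injective independent) ↣-∘ Fin^↣Vec Fin-size↣Carrier k)
        λ i → Equivalence.from (Q≡imφ _) (Injection.to (Fin^↣Vec Fin-size↣Carrier k) i , refl)

      ψ-onto : ∀ {n} {w : Vec (Vec Carrier ℓ) n} → InPower 𝔽 Q w → ∃[ y ] ψ y ≡ w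
      ψ-onto {w = w} w∈Qⁿ = fromColumns β , (begin
        tabulate (λ i → φ (column i (fromColumns β))) ≡⟨ tabulate-cong (λ i → cong φ (column-fromColumns β i)) ⟩
        tabulate (λ i → φ (β i))                      ≡⟨ tabulate-cong (λ i → proj₂ (φ-onto (Allᵥ.lookup⁺ w∈Qⁿ i))) ⟩
        tabulate (lookup w)                           ≡⟨ tabulate∘lookup w ⟩
        w                                             ∎)
        where
        β : Fin _ → Vec Carrier k
        β i = proj₁ (φ-onto (Allᵥ.lookup⁺ w∈Qⁿ i))

      ψ-grid⇒forbiddenSubgraph : ∀ {n} (A : List (Vec (Vec Carrier n) k)) →
        ContainsGrid 𝔽 n k A → ContainsForbiddenSubgraph 𝔽 n Q (List.map ψ A)
      ψ-grid⇒forbiddenSubgraph {n} A (x , d , d≢0 , grid⊆A) =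
        e , i , (λ r → ∈-map⁺ ψ (grid⊆A (α r))) ,
        (λ r → subst (_∈ Q) (sym (eᵢ≡Qᵣ r)) (∈-lookup r)) ,
        (λ y y∈Q → index y∈Q , trans (eᵢ≡Qᵣ _) (sym (lookup-index y∈Q))) ,
        columns-agree
        where
        i : Fin n
        i = proj₁ (≢0ᵥ⇒nonzero-entry d d≢0)
        dᵢ≢0 : lookup d i ≢ 0#
        dᵢ≢0 = proj₂ (≢0ᵥ⇒nonzero-entry d d≢0)
        β : Fin (List.length Q) → Vec Carrier k
        β r = proj₁ (φ-onto (∈-lookup r))
        α : Fin (List.length Q) → Vec Carrier k
        α r = proj₁ (+ᵥ-·ᵥ-solvable dᵢ≢0 (column i x) (β r))
        e : Fin (List.length Q) → Vec (Vec Carrier ℓ) n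
        e r = ψ (gridPoint x (α r) d)

        eᵢ≡Qᵣ : ∀ r → lookup (e r) i ≡ List.lookup Q r
        eᵢ≡Qᵣ r = begin
          lookup (e r) i                           ≡⟨ lookup-ψ (gridPoint x (α r) d) i ⟩
          φ (column i (gridPoint x (α r) d))       ≡⟨ cong φ (column-gridPoint x (α r) d i) ⟩
          φ (column i x +ᵥ lookup d i ·ᵥ α r)      ≡⟨ cong φ (proj₂ (+ᵥ-·ᵥ-solvable dᵢ≢0 (column i x) (β r))) ⟩
          φ (β r)                                  ≡⟨ proj₂ (φ-onto (∈-lookup r)) ⟩
          List.lookup Q r                          ∎

        columns-agree : ∀ j r r′ → lookup (lookup (e r) i) j ≡ lookup (lookup (e r′) i) j →
          column j (e r) ≡ column j (e r′)
        columns-agree j r r′ eᵣ≡eᵣ′ = trans (column-e r) (trans (cong line sᵣ≡sᵣ′) (sym (column-e r′)))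
          where
          s : Fin (List.length Q) → Carrier
          s r = lookup (lincomb (α r) v) j
          line : Carrier → Vec Carrier n
          line t = tabulate (λ i′ → lookup (φ (column i′ x)) j + lookup d i′ * t)
          column-e : ∀ r → column j (e r) ≡ line (s r)
          column-e r = trans (column≡tabulate j (e r)) (tabulate-cong (λ i′ → entry-ψ-gridPoint x (α r) d i′ j))
          sᵣ≡sᵣ′ : s r ≡ s r′
          sᵣ≡sᵣ′ = *-cancelˡ-≢0 dᵢ≢0 (∙-cancelˡ _ _ _
            (trans (sym (entry-ψ-gridPoint x (α r) d i j)) (trans eᵣ≡eᵣ′ (entry-ψ-gridPoint x (α r′) d i j))))

proposition4p11 : (𝔽 : FiniteField) (k ℓ : ℕ) → k ≤ ℓ →
    (Q : List (Vec (FiniteField.Carrier 𝔽) ℓ)) → Unique Q →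
    IsAffineSubspace 𝔽 k Q →
    ∀ (n : ℕ) → EQ≤rgrid 𝔽 Q k n
proposition4p11 𝔽 k ℓ _ Q _ (p , v , independent , Q≡imφ) n W W-unique W⊆Qⁿ W-free =
  A , map⁻ (subst Unique (sym ψA≡W) W-unique) , A-gridFree , counting
  where
  open Parametrisation 𝔽 p v
  preimage : ∃[ A ] List.map ψ A ≡ W
  preimage = map-preimage ψ W λ w w∈W → ψ-onto Q Q≡imφ (W⊆Qⁿ w w∈W)
  A : List (Vec (Vec (FiniteField.Carrier 𝔽) n) k)
  A = proj₁ preimage
  ψA≡W : List.map ψ A ≡ W
  ψA≡W = proj₂ preimage

  A-gridFree : ¬ ContainsGrid 𝔽 n k A
  A-gridFree grid = W-free (subst (ContainsForbiddenSubgraph 𝔽 n Q) ψA≡W (ψ-grid⇒forbiddenSubgraph Q Q≡imφ A grid))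

  counting : List.length W ℕ.* FiniteField.size 𝔽 ℕ.^ (k ℕ.* n) ≤ List.length A ℕ.* List.length Q ℕ.^ n
  counting = ℕ.*-mono-≤ (ℕ.≤-reflexive (trans (cong List.length (sym ψA≡W)) (length-map ψ A)))
    (subst (_≤ List.length Q ℕ.^ n) (ℕ.^-*-assoc (FiniteField.size 𝔽) k n) (ℕ.^-monoˡ-≤ n (size^k≤|Q| Q Q≡imφ independent)))
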